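{- Let $\mathscr{P}_{T_{\mathrm{II}}}$ be the set of partitions $\lambda_1\ge\lambda_2\ge\cdots\ge\lambda_\ell\ge1$ (empty partition included) with $\lambda_i-\lambda_{i+2}\ge 3$ for all applicable $i$, and such that $\lambda_i-\lambda_{i+1}\le 1$ implies $\lambda_i+\lambda_{i+1}\equiv 2\pmod 3$. Let $G(x)=G(x,q)=\sum_{\lambda\in\mathscr{P}_{T_{\mathrm{II}}}}x^{\sharp(\lambda)}q^{|\lambda|}$, where $\sharp(\lambda)$ is the number of parts and $|\lambda|$ the sum of parts. Then $$p_0(x,q)G(x)+p_3(x,q)G(xq^3)+p_6(x,q)G(xq^6)+p_9(x,q)G(xq^9)=0,$$ where \begin{align*} p_0&=1+x(q^4+q^5),\\ p_3&=-1-x(q+q^2+q^3+q^4+q^5)-x^2(q^2+q^4+2q^5+2q^6+q^7+q^8)-x^3(q^6+q^7+q^9+q^{10}),\\ p_6&=x^3(q^{10}+q^{11})+x^4(q^{12}+q^{13}+q^{14}+q^{15}+q^{16})+x^5(q^{17}+q^{18}),\\ p_9&=x^5q^{26}+x^6(q^{27}+q^{28}). \end{align*} -}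

module Defs where

open import Data.Nat using (ℕ; zero; suc; _+_; _*_; _∸_; _≤_; _≤ᵇ_)
open import Data.Nat.DivMod using (_%_)
open import Data.Bool using (Bool; true; false; if_then_else_; _∧_)
open import Data.Integer as ℤ using (ℤ; +_; -_)
open import Data.List using (List; []; _∷_; length)
open import Data.List.Relation.Unary.All using (All)
open import Data.Product using (_×_; _,_)
open import Data.Unit using (⊤)
open import Relation.Binary.PropositionalEquality using (_≡_)

WeaklyDecreasing : List ℕ → Set
WeaklyDecreasing []            = ⊤
WeaklyDecreasing (x ∷ [])      = ⊤
WeaklyDecreasing (x ∷ y ∷ r)   = y ≤ x × WeaklyDecreasing (y ∷ r)

IsPartition : List ℕ → Set
IsPartition l = WeaklyDecreasing l × All (1 ≤_) l

Gap3At2 : List ℕ → Set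
Gap3At2 (x ∷ y ∷ z ∷ r) = z + 3 ≤ x × Gap3At2 (y ∷ z ∷ r)
Gap3At2 _               = ⊤

-- λ_i - λ_{i+1} ≤ 1 implies λ_i + λ_{i+1} ≡ 2 (mod 3)
-- (for a weakly decreasing list, λ_i - λ_{i+1} ≤ 1 is λ_i ≤ λ_{i+1} + 1)
CloseCond : List ℕ → Set
CloseCond (x ∷ y ∷ r) = (x ≤ y + 1 → (x + y) % 3 ≡ 2) × CloseCond (y ∷ r)
CloseCond _           = ⊤

InPTII : List ℕ → Set
InPTII l = IsPartition l × Gap3At2 l × CloseCond l

-- Formal bivariate power series in x, q with integer coefficients:
-- S n m is the coefficient of x^n q^m.
Series : Set
Series = ℕ → ℕ → ℤ

-- the series F(x q^k): coefficient of x^n q^m is F_{n, m - k n}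
substXq : ℕ → Series → Series
substXq k F n m = if k * n ≤ᵇ m then F n (m ∸ k * n) else + 0

monoMul : ℤ → ℕ → ℕ → Series → Series
monoMul c a b F n m =
  if (a ≤ᵇ n) ∧ (b ≤ᵇ m) then c ℤ.* F (n ∸ a) (m ∸ b) else + 0

-- polynomials in x, q as lists of terms (c , a , b) meaning c x^a q^b
Poly : Set
Poly = List (ℤ × ℕ × ℕ)

polyMul : Poly → Series → Series
polyMul []                  F n m = + 0
polyMul ((c , a , b) ∷ ps)  F n m = monoMul c a b F n m ℤ.+ polyMul ps F n m

_⊕_ : Series → Series → Series
(F ⊕ H) n m = F n m ℤ.+ H n m
infixl 6 _⊕_

p0 : Poly
p0 = (+ 1 , 0 , 0) ∷ (+ 1 , 1 , 4) ∷ (+ 1 , 1 , 5) ∷ []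

p3 : Poly
p3 = (- + 1 , 0 , 0)
   ∷ (- + 1 , 1 , 1) ∷ (- + 1 , 1 , 2) ∷ (- + 1 , 1 , 3) ∷ (- + 1 , 1 , 4) ∷ (- + 1 , 1 , 5)
   ∷ (- + 1 , 2 , 2) ∷ (- + 1 , 2 , 4) ∷ (- + 2 , 2 , 5) ∷ (- + 2 , 2 , 6) ∷ (- + 1 , 2 , 7) ∷ (- + 1 , 2 , 8)
   ∷ (- + 1 , 3 , 6) ∷ (- + 1 , 3 , 7) ∷ (- + 1 , 3 , 9) ∷ (- + 1 , 3 , 10)
   ∷ []

p6 : Poly
p6 = (+ 1 , 3 , 10) ∷ (+ 1 , 3 , 11)
   ∷ (+ 1 , 4 , 12) ∷ (+ 1 , 4 , 13) ∷ (+ 1 , 4 , 14) ∷ (+ 1 , 4 , 15) ∷ (+ 1 , 4 , 16)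
   ∷ (+ 1 , 5 , 17) ∷ (+ 1 , 5 , 18)
   ∷ []

p9 : Poly
p9 = (+ 1 , 5 , 26) ∷ (+ 1 , 6 , 27) ∷ (+ 1 , 6 , 28) ∷ []

lhsSeries : Series → Series
lhsSeries G = polyMul p0 G ⊕ polyMul p3 (substXq 3 G)
            ⊕ polyMul p6 (substXq 6 G) ⊕ polyMul p9 (substXq 9 G)

module Submission where

-- Read partitions with their parts in increasing order and, for u ≥ 1,
-- let G_u count the admissible lists all of whose parts are at least u, so
-- that G = G₁ and G_{u+3}(x) = G_u(xq³) (AscendingForm).  Classifying the
-- lists by their two smallest parts (Recurrences.first-parts) and deciding,
-- for u = 1, 2, 3, which pairs of smallest parts are allowed yields three
-- linear q-difference relations R₁, R₂, R₃ between G₁, G₂, G₃.  The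
-- functional equation is an explicit combination of copies x^a q^b R_i(xq^s)
-- of these relations, checked by normalising linear forms (LinearForms,
-- FunctionalEquation).  Coefficients are read at integer exponents, zero when
-- an exponent is negative, so that shifts need no side conditions
-- (Coefficients).

open import Defs

module Coefficients where
  open import Data.Nat as ℕ using (ℕ; zero; suc; _≤_; _<_; _≤ᵇ_; _∸_)
  import Data.Nat.Properties as ℕ
  open import Data.Integer as ℤ using (ℤ; +_; -[1+_]; _+_; _*_; _-_; -_)
  import Data.Integer.Properties as ℤ
  open import Data.Bool using (true; false)
  open import Relation.Nullary.Reflects using (ofʸ; ofⁿ)
  open import Relation.Binary.PropositionalEquality

  coeff : Series → ℤ → ℤ → ℤ
  coeff F (+ n) (+ m)     = F n m
  coeff F (+ n) -[1+ m ]  = + 0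
  coeff F -[1+ n ] M      = + 0

  coeff-negative : ∀ F N m → coeff F N -[1+ m ] ≡ + 0
  coeff-negative F (+ n)    m = refl
  coeff-negative F -[1+ n ] m = refl

  coeff-cong : ∀ {F H} → (∀ n m → F n m ≡ H n m) → ∀ N M → coeff F N M ≡ coeff H N M
  coeff-cong F≗H (+ n)    (+ m)    = F≗H n m
  coeff-cong F≗H (+ n)    -[1+ m ] = refl
  coeff-cong F≗H -[1+ n ] M        = refl

  coeff-⊕ : ∀ F H N M → coeff (F ⊕ H) N M ≡ coeff F N M + coeff H N M
  coeff-⊕ F H (+ n)    (+ m)    = refl
  coeff-⊕ F H (+ n)    -[1+ m ] = refl
  coeff-⊕ F H -[1+ n ] M        = refl

  minus-≥ : ∀ {x a} → a ≤ x → + x - + a ≡ + (x ∸ a)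
  minus-≥ {x} {a} a≤x = trans (ℤ.m-n≡m⊖n x a) (ℤ.⊖-≥ a≤x)

  minus-< : ∀ {x a} → x < a → + x - + a ≡ -[1+ (a ∸ suc x) ]
  minus-< {x} {a} x<a =
    trans (ℤ.m-n≡m⊖n x a) (trans (ℤ.⊖-< x<a) (cong (λ d → - (+ d)) (ℕ.+-∸-assoc 1 x<a)))

  negative-minus : ∀ x a → -[1+ x ] - + a ≡ -[1+ (x ℕ.+ a) ]
  negative-minus x zero    = cong -[1+_] (sym (ℕ.+-identityʳ x))
  negative-minus x (suc a) = cong -[1+_] (sym (ℕ.+-suc x a))

  coeff-monoMul : ∀ c a b F N M → coeff (monoMul c a b F) N M ≡ c * coeff F (N - + a) (M - + b)
  coeff-monoMul c a b F -[1+ n ] M rewrite negative-minus n a = sym (ℤ.*-zeroʳ c)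
  coeff-monoMul c a b F (+ n) -[1+ m ] rewrite negative-minus m b =
    sym (trans (cong (c *_) (coeff-negative F (+ n - + a) (m ℕ.+ b))) (ℤ.*-zeroʳ c))
  coeff-monoMul c a b F (+ n) (+ m)
    with a ≤ᵇ n | ℕ.≤ᵇ-reflects-≤ a n | b ≤ᵇ m | ℕ.≤ᵇ-reflects-≤ b m
  ... | true  | ofʸ a≤n | true  | ofʸ b≤m rewrite minus-≥ a≤n | minus-≥ b≤m = refl
  ... | true  | ofʸ a≤n | false | ofⁿ b≰m
    rewrite minus-≥ a≤n | minus-< (ℕ.≰⇒> b≰m) = sym (ℤ.*-zeroʳ c)
  ... | false | ofⁿ a≰n | _     | _ rewrite minus-< (ℕ.≰⇒> a≰n) = sym (ℤ.*-zeroʳ c)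

  coeff-substXq : ∀ k G N M → coeff (substXq k G) N M ≡ coeff G N (M - + k * N)
  coeff-substXq k G -[1+ n ] M = refl
  coeff-substXq k G (+ n) -[1+ m ]
    rewrite sym (ℤ.pos-* k n) | negative-minus m (k ℕ.* n) = refl
  coeff-substXq k G (+ n) (+ m) rewrite sym (ℤ.pos-* k n)
    with k ℕ.* n ≤ᵇ m | ℕ.≤ᵇ-reflects-≤ (k ℕ.* n) m
  ... | true  | ofʸ kn≤m rewrite minus-≥ kn≤m = refl
  ... | false | ofⁿ kn≰m rewrite minus-< (ℕ.≰⇒> kn≰m) = refl

module LinearForms where
  open import Data.Nat as ℕ using (ℕ)
  import Data.Nat.Properties as ℕ
  open import Data.Integer as ℤ using (ℤ; +_; _+_; _*_; _-_; -_)
  import Data.Integer.Properties as ℤ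
  open import Data.Integer.Tactic.RingSolver using (solve-∀)
  open import Data.Fin using (Fin)
  open import Data.List using (List; []; _∷_; _++_; map; foldr)
  open import Data.Product using (_×_; _,_)
  open import Data.Product.Properties using (≡-dec)
  open import Relation.Nullary using (yes; no)
  open import Relation.Binary.Definitions using (DecidableEquality)
  open import Relation.Binary.PropositionalEquality
  open ≡-Reasoning

  -- A family of coefficient functions T k N M, one series G_k for each level k.
  Family : Set
  Family = ℕ → ℤ → ℤ → ℤ

  -- The atom (k , a , b , s) stands for T_k(N − a, M − b − s(N − a)), which is
  -- the coefficient of x^N q^M in x^a q^b G_k(x q^s).
  Atom : Set
  Atom = ℕ × ℕ × ℕ × ℕ

  atomValue : Family → Atom → ℤ → ℤ → ℤ
  atomValue T (k , a , b , s) N M = T k (N - + a) (M - + b - + s * (N - + a))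

  LinearForm : Set
  LinearForm = List (ℤ × Atom)

  ⟦_⟧ : LinearForm → Family → ℤ → ℤ → ℤ
  ⟦ [] ⟧          T N M = + 0
  ⟦ (c , x) ∷ F ⟧ T N M = c * atomValue T x N M + ⟦ F ⟧ T N M

  Satisfies : Family → LinearForm → Set
  Satisfies T F = ∀ N M → ⟦ F ⟧ T N M ≡ + 0

  ⟦++⟧ : ∀ F F′ T N M → ⟦ F ++ F′ ⟧ T N M ≡ ⟦ F ⟧ T N M + ⟦ F′ ⟧ T N M
  ⟦++⟧ []            F′ T N M = sym (ℤ.+-identityˡ _)
  ⟦++⟧ ((c , x) ∷ F) F′ T N M rewrite ⟦++⟧ F F′ T N M =
    sym (ℤ.+-assoc (c * atomValue T x N M) (⟦ F ⟧ T N M) (⟦ F′ ⟧ T N M))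

  scale : ℤ → LinearForm → LinearForm
  scale d = map (λ (c , x) → (d * c , x))

  ⟦scale⟧ : ∀ d F T N M → ⟦ scale d F ⟧ T N M ≡ d * ⟦ F ⟧ T N M
  ⟦scale⟧ d []            T N M = sym (ℤ.*-zeroʳ d)
  ⟦scale⟧ d ((c , x) ∷ F) T N M rewrite ⟦scale⟧ d F T N M =
    trans (cong (_+ d * ⟦ F ⟧ T N M) (ℤ.*-assoc d c _))
          (sym (ℤ.*-distribˡ-+ d (c * atomValue T x N M) _))

  -- The shift (a′ , b′ , s′) sends a form F(x) to x^a′ q^b′ F(x q^s′); on
  -- coefficients it moves the point (N , M) to (N − a′ , M − b′ − s′(N − a′)).
  Shift : Set
  Shift = ℕ × ℕ × ℕ

  shiftAtom : Shift → Atom → Atom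
  shiftAtom (a′ , b′ , s′) (k , a , b , s) = (k , a ℕ.+ a′ , b ℕ.+ b′ ℕ.+ s′ ℕ.* a , s ℕ.+ s′)

  shift : Shift → LinearForm → LinearForm
  shift σ = map (λ (c , x) → (c , shiftAtom σ x))

  atomValue-shift : ∀ T a′ b′ s′ x N M →
    atomValue T (shiftAtom (a′ , b′ , s′) x) N M
      ≡ atomValue T x (N - + a′) (M - + b′ - + s′ * (N - + a′))
  atomValue-shift T a′ b′ s′ (k , a , b , s) N M = cong₂ (T k) first second
    where
      moved : ∀ N a a′ → N - (a + a′) ≡ N - a′ - a
      moved = solve-∀
      first : N - + (a ℕ.+ a′) ≡ N - + a′ - + a
      first = trans (cong (λ u → N - u) (ℤ.pos-+ a a′)) (moved N (+ a) (+ a′))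
      composed : ∀ N M a b s a′ b′ s′ →
        M - (b + b′ + s′ * a) - (s + s′) * (N - (a + a′))
          ≡ M - b′ - s′ * (N - a′) - b - s * (N - a′ - a)
      composed = solve-∀
      second : M - + (b ℕ.+ b′ ℕ.+ s′ ℕ.* a) - + (s ℕ.+ s′) * (N - + (a ℕ.+ a′))
             ≡ M - + b′ - + s′ * (N - + a′) - + b - + s * (N - + a′ - + a)
      second = begin
        M - + (b ℕ.+ b′ ℕ.+ s′ ℕ.* a) - + (s ℕ.+ s′) * (N - + (a ℕ.+ a′))
          ≡⟨ cong (λ u → M - u - + (s ℕ.+ s′) * (N - + (a ℕ.+ a′)))
                  (trans (ℤ.pos-+ (b ℕ.+ b′) (s′ ℕ.* a)) (cong₂ _+_ (ℤ.pos-+ b b′) (ℤ.pos-* s′ a))) ⟩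
        M - (+ b + + b′ + + s′ * + a) - + (s ℕ.+ s′) * (N - + (a ℕ.+ a′))
          ≡⟨ cong₂ (λ v w → M - (+ b + + b′ + + s′ * + a) - v * (N - w)) (ℤ.pos-+ s s′) (ℤ.pos-+ a a′) ⟩
        M - (+ b + + b′ + + s′ * + a) - (+ s + + s′) * (N - (+ a + + a′))
          ≡⟨ composed N M (+ a) (+ b) (+ s) (+ a′) (+ b′) (+ s′) ⟩
        M - + b′ - + s′ * (N - + a′) - + b - + s * (N - + a′ - + a) ∎

  ⟦shift⟧ : ∀ a′ b′ s′ F T N M →
    ⟦ shift (a′ , b′ , s′) F ⟧ T N M ≡ ⟦ F ⟧ T (N - + a′) (M - + b′ - + s′ * (N - + a′))
  ⟦shift⟧ a′ b′ s′ []            T N M = refl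
  ⟦shift⟧ a′ b′ s′ ((c , x) ∷ F) T N M =
    cong₂ (λ v w → c * v + w) (atomValue-shift T a′ b′ s′ x N M) (⟦shift⟧ a′ b′ s′ F T N M)

  _≟ᵃ_ : DecidableEquality Atom
  _≟ᵃ_ = ≡-dec ℕ._≟_ (≡-dec ℕ._≟_ (≡-dec ℕ._≟_ ℕ._≟_))

  insert : ℤ × Atom → LinearForm → LinearForm
  insert t [] = t ∷ []
  insert (c , x) ((d , y) ∷ F) with x ≟ᵃ y
  ... | yes _ = (c + d , y) ∷ F
  ... | no _  = (d , y) ∷ insert (c , x) F

  dropZeros : LinearForm → LinearForm
  dropZeros []              = []
  dropZeros ((+ 0 , x) ∷ F) = dropZeros F
  dropZeros (t ∷ F)         = t ∷ dropZeros F

  normalForm : LinearForm → LinearForm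
  normalForm F = dropZeros (foldr insert [] F)

  ⟦insert⟧ : ∀ c x F T N M → ⟦ insert (c , x) F ⟧ T N M ≡ c * atomValue T x N M + ⟦ F ⟧ T N M
  ⟦insert⟧ c x []            T N M = refl
  ⟦insert⟧ c x ((d , y) ∷ F) T N M with x ≟ᵃ y
  ... | yes refl = trans (cong (λ v → v + ⟦ F ⟧ T N M) (ℤ.*-distribʳ-+ (atomValue T y N M) c d))
                          (ℤ.+-assoc (c * atomValue T y N M) (d * atomValue T y N M) (⟦ F ⟧ T N M))
  ... | no _ rewrite ⟦insert⟧ c x F T N M =
    exchange (d * atomValue T y N M) (c * atomValue T x N M) (⟦ F ⟧ T N M)
    where
      exchange : ∀ u v w → u + (v + w) ≡ v + (u + w)
      exchange = solve-∀

  ⟦dropZeros⟧ : ∀ F T N M → ⟦ dropZeros F ⟧ T N M ≡ ⟦ F ⟧ T N M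
  ⟦dropZeros⟧ []              T N M = refl
  ⟦dropZeros⟧ ((+ 0 , x) ∷ F) T N M = trans (⟦dropZeros⟧ F T N M) (sym (ℤ.+-identityˡ _))
  ⟦dropZeros⟧ ((+ ℕ.suc c , x) ∷ F) T N M = cong (λ v → + ℕ.suc c * atomValue T x N M + v) (⟦dropZeros⟧ F T N M)
  ⟦dropZeros⟧ ((ℤ.-[1+ c ] , x) ∷ F) T N M = cong (λ v → ℤ.-[1+ c ] * atomValue T x N M + v) (⟦dropZeros⟧ F T N M)

  ⟦normalForm⟧ : ∀ F T N M → ⟦ normalForm F ⟧ T N M ≡ ⟦ F ⟧ T N M
  ⟦normalForm⟧ F T N M = trans (⟦dropZeros⟧ (foldr insert [] F) T N M) (merged F)
    where
      merged : ∀ F → ⟦ foldr insert [] F ⟧ T N M ≡ ⟦ F ⟧ T N M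
      merged []            = refl
      merged ((c , x) ∷ F) =
        trans (⟦insert⟧ c x (foldr insert [] F) T N M) (cong (λ v → c * atomValue T x N M + v) (merged F))

  combination : ∀ {r} → (Fin r → LinearForm) → List (ℤ × Fin r × Shift) → LinearForm
  combination R []                  = []
  combination R ((c , i , σ) ∷ C) = scale c (shift σ (R i)) ++ combination R C

  combination-satisfies : ∀ {r} T (R : Fin r → LinearForm) → (∀ i → Satisfies T (R i)) →
    ∀ C → Satisfies T (combination R C)
  combination-satisfies T R sat [] N M = refl
  combination-satisfies T R sat ((c , i , (a′ , b′ , s′)) ∷ C) N M = begin
    ⟦ scale c (shift σ (R i)) ++ combination R C ⟧ T N M
      ≡⟨ ⟦++⟧ (scale c (shift σ (R i))) (combination R C) T N M ⟩
    ⟦ scale c (shift σ (R i)) ⟧ T N M + ⟦ combination R C ⟧ T N M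
      ≡⟨ cong₂ _+_ (⟦scale⟧ c (shift σ (R i)) T N M) (combination-satisfies T R sat C N M) ⟩
    c * ⟦ shift σ (R i) ⟧ T N M + + 0
      ≡⟨ cong (λ v → c * v + + 0) (trans (⟦shift⟧ a′ b′ s′ (R i) T N M) (sat i _ _)) ⟩
    c * + 0 + + 0
      ≡⟨ cong (_+ + 0) (ℤ.*-zeroʳ c) ⟩
    + 0 ∎
    where
      σ : Shift
      σ = (a′ , b′ , s′)

  satisfies-by-certificate : ∀ {r} T (R : Fin r → LinearForm) → (∀ i → Satisfies T (R i)) →
    ∀ F C → normalForm (F ++ scale (- + 1) (combination R C)) ≡ [] → Satisfies T F
  satisfies-by-certificate T R sat F C vanishes N M = begin
    ⟦ F ⟧ T N M                                      ≡⟨ add-zero _ ⟩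
    ⟦ F ⟧ T N M + - + 1 * + 0                        ≡⟨ cong (λ v → ⟦ F ⟧ T N M + - + 1 * v)
                                                          (sym (combination-satisfies T R sat C N M)) ⟩
    ⟦ F ⟧ T N M + - + 1 * ⟦ combination R C ⟧ T N M ≡⟨ cong (λ v → ⟦ F ⟧ T N M + v)
                                                          (sym (⟦scale⟧ (- + 1) (combination R C) T N M)) ⟩
    ⟦ F ⟧ T N M + ⟦ D ⟧ T N M                         ≡⟨ sym (⟦++⟧ F D T N M) ⟩
    ⟦ F ++ D ⟧ T N M                                 ≡⟨ sym (⟦normalForm⟧ (F ++ D) T N M) ⟩
    ⟦ normalForm (F ++ D) ⟧ T N M                    ≡⟨ cong (λ G → ⟦ G ⟧ T N M) vanishes ⟩
    + 0 ∎
    where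
      D : LinearForm
      D = scale (- + 1) (combination R C)
      add-zero : ∀ u → u ≡ u + - + 1 * + 0
      add-zero = solve-∀

module FunctionalEquation where
  open import Data.Nat as ℕ using (ℕ)
  open import Data.Integer as ℤ using (ℤ; +_; _+_; _*_; _-_; -_)
  open import Data.Fin using (Fin; zero; suc)
  open import Data.List using (List; []; _∷_; _++_; map)
  open import Data.Product using (_×_; _,_)
  open import Relation.Binary.PropositionalEquality
  open ≡-Reasoning
  open Coefficients
  open LinearForms

  -- The three recurrences for the coefficients T₁, T₂, T₃ of G₁, G₂, G₃:
  --   R₁ :  T₁(N,M) − T₂(N,M) − T₃(N−1,M−1) − T₁(N−2, M−2−3(N−2)) = 0
  --   R₂ :  T₂(N,M) − T₃(N,M) − T₂(N−2, M−5−3(N−2)) − T₁(N−1, M−2−3(N−1))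
  --                                                + T₁(N−3, M−10−6(N−3)) = 0
  --   R₃ :  T₃(N,M) − T₁(N, M−3N) − T₂(N−1, M−3−3(N−1)) = 0
  pattern R₁ = zero
  pattern R₂ = suc zero
  pattern R₃ = suc (suc zero)

  recurrence : Fin 3 → LinearForm
  recurrence R₁ = (+ 1 , 1 , 0 , 0 , 0) ∷ (- + 1 , 2 , 0 , 0 , 0) ∷ (- + 1 , 3 , 1 , 1 , 0)
                ∷ (- + 1 , 1 , 2 , 2 , 3) ∷ []
  recurrence R₂ = (+ 1 , 2 , 0 , 0 , 0) ∷ (- + 1 , 3 , 0 , 0 , 0) ∷ (- + 1 , 2 , 2 , 5 , 3)
                ∷ (- + 1 , 1 , 1 , 2 , 3) ∷ (+ 1 , 1 , 3 , 10 , 6) ∷ []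
  recurrence R₃ = (+ 1 , 3 , 0 , 0 , 0) ∷ (- + 1 , 1 , 0 , 0 , 3) ∷ (- + 1 , 2 , 1 , 3 , 3) ∷ []

  polyForm : ℕ → Poly → LinearForm
  polyForm k = map (λ (c , a , b) → (c , 1 , a , b , k))

  lhsForm : LinearForm
  lhsForm = ((polyForm 0 p0 ++ polyForm 3 p3) ++ polyForm 6 p6) ++ polyForm 9 p9

  -- The left-hand side is the combination
  --     (1 + xq⁴ + xq⁵) R₁(x) − (xq³ + x²q⁴ + x²q⁵ + x²q⁸ + x³q⁹ + x³q¹⁰) R₁(xq³)
  --   + (1 + xq⁴ + xq⁵) R₂(x) + (x²q⁷ + x³q⁸ + x³q⁹) R₂(xq³)
  --   + (1 + xq + xq⁴ + xq⁵ + x²q⁵ + x²q⁶) R₃(x) − (x³q¹² + x⁴q¹³ + x⁴q¹⁴) R₃(xq³),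
  -- each term c x^a q^b R(xq^s) being listed as (c , R , a , b , s).
  certificate : List (ℤ × Fin 3 × Shift)
  certificate =
      (+ 1 , R₁ , 0 , 0 , 0)   ∷ (+ 1 , R₁ , 1 , 4 , 0)   ∷ (+ 1 , R₁ , 1 , 5 , 0)
    ∷ (- + 1 , R₁ , 1 , 3 , 3) ∷ (- + 1 , R₁ , 2 , 4 , 3) ∷ (- + 1 , R₁ , 2 , 5 , 3)
    ∷ (- + 1 , R₁ , 2 , 8 , 3) ∷ (- + 1 , R₁ , 3 , 9 , 3) ∷ (- + 1 , R₁ , 3 , 10 , 3)
    ∷ (+ 1 , R₂ , 0 , 0 , 0)   ∷ (+ 1 , R₂ , 1 , 4 , 0)   ∷ (+ 1 , R₂ , 1 , 5 , 0)
    ∷ (+ 1 , R₂ , 2 , 7 , 3)   ∷ (+ 1 , R₂ , 3 , 8 , 3)   ∷ (+ 1 , R₂ , 3 , 9 , 3)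
    ∷ (+ 1 , R₃ , 0 , 0 , 0)   ∷ (+ 1 , R₃ , 1 , 1 , 0)   ∷ (+ 1 , R₃ , 1 , 4 , 0)
    ∷ (+ 1 , R₃ , 1 , 5 , 0)   ∷ (+ 1 , R₃ , 2 , 5 , 0)   ∷ (+ 1 , R₃ , 2 , 6 , 0)
    ∷ (- + 1 , R₃ , 3 , 12 , 3) ∷ (- + 1 , R₃ , 4 , 13 , 3) ∷ (- + 1 , R₃ , 4 , 14 , 3)
    ∷ []

  lhsForm-vanishes : ∀ T → (∀ i → Satisfies T (recurrence i)) → Satisfies T lhsForm
  lhsForm-vanishes T sat = satisfies-by-certificate T recurrence sat lhsForm certificate refl

  polyMul-form : ∀ G T → (∀ N M → coeff G N M ≡ T 1 N M) →
    ∀ k P n m → polyMul P (substXq k G) n m ≡ ⟦ polyForm k P ⟧ T (+ n) (+ m)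
  polyMul-form G T G≡T₁ k []                n m = refl
  polyMul-form G T G≡T₁ k ((c , a , b) ∷ P) n m = cong₂ _+_ monomial (polyMul-form G T G≡T₁ k P n m)
    where
      N′ : ℤ
      N′ = + n - + a
      monomial : monoMul c a b (substXq k G) n m ≡ c * T 1 N′ (+ m - + b - + k * N′)
      monomial = trans (coeff-monoMul c a b (substXq k G) (+ n) (+ m))
                       (cong (c *_) (trans (coeff-substXq k G N′ (+ m - + b)) (G≡T₁ _ _)))

  lhsSeries-form : ∀ G T → (∀ N M → coeff G N M ≡ T 1 N M) →
    ∀ n m → lhsSeries G n m ≡ ⟦ lhsForm ⟧ T (+ n) (+ m)
  lhsSeries-form G T G≡T₁ n m = begin
    lhsSeries G n m
      ≡⟨ cong₂ _+_ (cong₂ _+_ (cong₂ _+_ (part 0 p0) (part 3 p3)) (part 6 p6)) (part 9 p9) ⟩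
    value f₀ + value f₃ + value f₆ + value f₉
      ≡⟨ cong (λ v → v + value f₆ + value f₉) (sym (⟦++⟧ f₀ f₃ T (+ n) (+ m))) ⟩
    value (f₀ ++ f₃) + value f₆ + value f₉
      ≡⟨ cong (λ v → v + value f₉) (sym (⟦++⟧ (f₀ ++ f₃) f₆ T (+ n) (+ m))) ⟩
    value ((f₀ ++ f₃) ++ f₆) + value f₉
      ≡⟨ sym (⟦++⟧ ((f₀ ++ f₃) ++ f₆) f₉ T (+ n) (+ m)) ⟩
    value lhsForm ∎
    where
      value : LinearForm → ℤ
      value F = ⟦ F ⟧ T (+ n) (+ m)
      f₀ f₃ f₆ f₉ : LinearForm
      f₀ = polyForm 0 p0
      f₃ = polyForm 3 p3
      f₆ = polyForm 6 p6
      f₉ = polyForm 9 p9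
      part : ∀ k P → polyMul P (substXq k G) n m ≡ value (polyForm k P)
      part k P = polyMul-form G T G≡T₁ k P n m

module Counting where
  open import Level using (0ℓ)
  open import Data.Nat as ℕ using (ℕ; zero; suc; _+_; _∸_; _≤_; _<_; _≤ᵇ_; z≤n)
  import Data.Nat.Properties as ℕ
  open import Data.Nat.ListAction using (sum)
  open import Data.Integer as ℤ using (ℤ)
  import Data.Integer.Properties as ℤ
  open import Data.Bool using (true; false)
  open import Data.Empty using (⊥; ⊥-elim)
  open import Data.List using (List; []; _∷_; _++_; map; length; filter)
  import Data.List.Properties as List
  open import Data.List.Membership.Propositional using (_∈_)
  open import Data.List.Membership.Propositional.Properties
    using (∈-map⁺; ∈-map⁻; ∈-++⁺ˡ; ∈-++⁺ʳ; ∈-++⁻; ∈-filter⁺; ∈-filter⁻)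
  open import Data.List.Membership.Propositional.Properties.WithK using (unique∧set⇒bag)
  open import Data.List.Relation.Binary.BagAndSetEquality using (∼bag⇒↭)
  open import Data.List.Relation.Binary.Permutation.Propositional.Properties using (↭-length)
  open import Data.List.Relation.Unary.Any using (here)
  open import Data.List.Relation.Unary.Unique.Propositional using (Unique; []; _∷_)
  import Data.List.Relation.Unary.Unique.Propositional.Properties as Unique
  open import Data.List.Relation.Unary.All using ([])
  open import Data.Product using (_×_; _,_; ∃; Σ-syntax; proj₁; proj₂)
  open import Data.Sum using (_⊎_; inj₁; inj₂)
  open import Function.Bundles using (_⇔_; mk⇔; Equivalence)
  open import Relation.Nullary using (¬_; yes; no)
  open import Relation.Nullary.Decidable using (_×-dec_)
  open import Relation.Nullary.Reflects using (ofʸ; ofⁿ)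
  open import Relation.Unary using (Pred; Decidable; _∩_)
  open import Relation.Unary.Properties using (_∩?_; ∁?)
  open import Relation.Binary.PropositionalEquality
  open Coefficients

  mutual
    compositions : ℕ → ℕ → List (List ℕ)
    compositions zero    zero    = [] ∷ []
    compositions zero    (suc m) = []
    compositions (suc n) m       = startingAtMost n m m

    startingAtMost : ℕ → ℕ → ℕ → List (List ℕ)
    startingAtMost n m zero    = map (0 ∷_) (compositions n m)
    startingAtMost n m (suc k) = startingAtMost n m k ++ map (suc k ∷_) (compositions n (m ∸ suc k))

  mutual
    compositions-sound : ∀ n m z → z ∈ compositions n m → length z ≡ n × sum z ≡ m
    compositions-sound zero zero .[] (here refl) = refl , refl
    compositions-sound (suc n) m z z∈ with startingAtMost-sound n m m z z∈
    ... | a , l , a≤m , refl , l∈ with compositions-sound n (m ∸ a) l l∈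
    ... | length≡ , sum≡ = cong suc length≡ , trans (cong (a +_) sum≡) (ℕ.m+[n∸m]≡n a≤m)

    startingAtMost-sound : ∀ n m k z → z ∈ startingAtMost n m k →
      ∃ λ a → ∃ λ l → a ≤ k × z ≡ a ∷ l × l ∈ compositions n (m ∸ a)
    startingAtMost-sound n m zero z z∈ with ∈-map⁻ (0 ∷_) z∈
    ... | l , l∈ , refl = 0 , l , z≤n , refl , l∈
    startingAtMost-sound n m (suc k) z z∈ with ∈-++⁻ (startingAtMost n m k) z∈
    ... | inj₁ z∈′ with startingAtMost-sound n m k z z∈′
    ...   | a , l , a≤k , z≡ , l∈ = a , l , ℕ.m≤n⇒m≤1+n a≤k , z≡ , l∈
    startingAtMost-sound n m (suc k) z z∈ | inj₂ z∈′ with ∈-map⁻ (suc k ∷_) z∈′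
    ... | l , l∈ , refl = suc k , l , ℕ.≤-refl , refl , l∈

  mutual
    compositions-complete : ∀ z → z ∈ compositions (length z) (sum z)
    compositions-complete []      = here refl
    compositions-complete (a ∷ l) =
      startingAtMost-complete (length l) (a + sum l) (a + sum l) a l (ℕ.m≤m+n a (sum l))
        (subst (λ s → l ∈ compositions (length l) s) (sym (ℕ.m+n∸m≡n a (sum l))) (compositions-complete l))

    startingAtMost-complete : ∀ n m k a l → a ≤ k → l ∈ compositions n (m ∸ a) → a ∷ l ∈ startingAtMost n m k
    startingAtMost-complete n m zero    .zero l z≤n l∈ = ∈-map⁺ (0 ∷_) l∈
    startingAtMost-complete n m (suc k) a    l a≤ l∈ with ℕ.m≤n⇒m<n∨m≡n a≤
    ... | inj₁ a<  = ∈-++⁺ˡ (startingAtMost-complete n m k a l (ℕ.≤-pred a<) l∈)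
    ... | inj₂ refl = ∈-++⁺ʳ (startingAtMost n m k) (∈-map⁺ (suc k ∷_) l∈)

  mutual
    compositions-unique : ∀ n m → Unique (compositions n m)
    compositions-unique zero    zero    = [] ∷ []
    compositions-unique zero    (suc m) = []
    compositions-unique (suc n) m       = startingAtMost-unique n m m

    startingAtMost-unique : ∀ n m k → Unique (startingAtMost n m k)
    startingAtMost-unique n m zero    = Unique.map⁺ List.∷-injectiveʳ (compositions-unique n m)
    startingAtMost-unique n m (suc k) =
      Unique.++⁺ (startingAtMost-unique n m k) (Unique.map⁺ List.∷-injectiveʳ (compositions-unique n _)) disjoint
      where
        -- the first block has heads ≤ k, the second has head suc k
        disjoint : ∀ {z} → ¬ (z ∈ startingAtMost n m k × z ∈ map (suc k ∷_) (compositions n (m ∸ suc k)))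
        disjoint (z∈ , z∈′) with startingAtMost-sound n m k _ z∈ | ∈-map⁻ (suc k ∷_) z∈′
        ... | a , l , a≤k , refl , _ | _ , _ , refl = ℕ.<-irrefl refl a≤k

  Shape : Pred (List ℕ) 0ℓ → ℕ → ℕ → List ℕ → Set
  Shape P n m z = P z × length z ≡ n × sum z ≡ m

  Enumerates : Pred (List ℕ) 0ℓ → ℕ → ℕ → List (List ℕ) → Set
  Enumerates P n m xs = Unique xs × (∀ z → z ∈ xs ⇔ Shape P n m z)

  enumerations-agree : ∀ {P n m xs ys} → Enumerates P n m xs → Enumerates P n m ys → length xs ≡ length ys
  enumerations-agree {xs = xs} {ys} (xs-unique , ∈xs) (ys-unique , ∈ys) =
    ↭-length (∼bag⇒↭ (unique∧set⇒bag xs-unique ys-unique (λ {z} →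
      mk⇔ (λ z∈ → Equivalence.from (∈ys z) (Equivalence.to (∈xs z) z∈))
          (λ z∈ → Equivalence.from (∈xs z) (Equivalence.to (∈ys z) z∈)))))

  count : ∀ {P : Pred (List ℕ) 0ℓ} → Decidable P → ℕ → ℕ → ℕ
  count P? n m = length (filter P? (compositions n m))

  count-enumerates : ∀ {P} (P? : Decidable P) n m → Enumerates P n m (filter P? (compositions n m))
  count-enumerates P? n m = Unique.filter⁺ P? (compositions-unique n m) , λ z → mk⇔
    (λ z∈ → let (z∈′ , Pz) = ∈-filter⁻ P? z∈ in Pz , compositions-sound n m z z∈′)
    (λ { (Pz , refl , refl) → ∈-filter⁺ P? (compositions-complete z) Pz })

  count-is-length : ∀ {P} (P? : Decidable P) {n m xs} → Enumerates P n m xs → count P? n m ≡ length xs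
  count-is-length P? {n} {m} = enumerations-agree (count-enumerates P? n m)

  enumerates-map : ∀ {P Q n m n′ m′ xs} (f : List ℕ → List ℕ) →
    (∀ {x y} → f x ≡ f y → x ≡ y) →
    (∀ l → Shape P n m l → Shape Q n′ m′ (f l)) →
    (∀ z → Shape Q n′ m′ z → Σ[ l ∈ List ℕ ] f l ≡ z × Shape P n m l) →
    Enumerates P n m xs → Enumerates Q n′ m′ (map f xs)
  enumerates-map {P} {Q} {n} {m} {n′} {m′} {xs} f f-injective forth back (xs-unique , ∈xs) =
    Unique.map⁺ f-injective xs-unique , λ z → mk⇔ (to z) (from z)
    where
      to : ∀ z → z ∈ map f xs → Shape Q n′ m′ z
      to z z∈ with ∈-map⁻ f z∈
      ... | l , l∈ , refl = forth l (Equivalence.to (∈xs l) l∈)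
      from : ∀ z → Shape Q n′ m′ z → z ∈ map f xs
      from z shape with back z shape
      ... | l , refl , shape′ = ∈-map⁺ f (Equivalence.from (∈xs l) shape′)

  count-transfer : ∀ {P Q} (P? : Decidable P) (Q? : Decidable Q) n m n′ m′ (f : List ℕ → List ℕ) →
    (∀ {x y} → f x ≡ f y → x ≡ y) →
    (∀ l → Shape P n m l → Shape Q n′ m′ (f l)) →
    (∀ z → Shape Q n′ m′ z → Σ[ l ∈ List ℕ ] f l ≡ z × Shape P n m l) →
    count Q? n′ m′ ≡ count P? n m
  count-transfer P? Q? n m n′ m′ f f-injective forth back =
    trans (count-is-length Q? (enumerates-map f f-injective forth back (count-enumerates P? n m)))
          (List.length-map f (filter P? (compositions n m)))

  count-cong : ∀ {P Q} (P? : Decidable P) (Q? : Decidable Q) → (∀ z → P z ⇔ Q z) →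
    ∀ n m → count P? n m ≡ count Q? n m
  count-cong P? Q? P⇔Q n m = count-transfer Q? P? n m n m (λ z → z) (λ x≡y → x≡y)
    (λ { l (Ql , shape) → Equivalence.from (P⇔Q l) Ql , shape })
    (λ { z (Pz , shape) → z , refl , Equivalence.to (P⇔Q z) Pz , shape })

  count-empty : ∀ {P} (P? : Decidable P) {n m} → (∀ z → ¬ Shape P n m z) → count P? n m ≡ 0
  count-empty P? no-shape = count-is-length P? ([] , λ z → mk⇔ (λ ()) (λ shape → ⊥-elim (no-shape z shape)))

  count-split : ∀ {P C} (P? : Decidable P) (C? : Decidable C) n m →
    count P? n m ≡ count (P? ∩? C?) n m + count (P? ∩? ∁? C?) n m
  count-split {P} {C} P? C? n m =
    trans (count-is-length P? (Unique.++⁺ (proj₁ with-C) (proj₁ without-C) disjoint , λ z → mk⇔ (to z) (from z)))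
          (List.length-++ xs)
    where
      xs ys : List (List ℕ)
      xs = filter (P? ∩? C?) (compositions n m)
      ys = filter (P? ∩? ∁? C?) (compositions n m)
      with-C : Enumerates (λ z → P z × C z) n m xs
      with-C = count-enumerates (P? ∩? C?) n m
      without-C : Enumerates (λ z → P z × ¬ C z) n m ys
      without-C = count-enumerates (P? ∩? ∁? C?) n m
      disjoint : ∀ {z} → ¬ (z ∈ xs × z ∈ ys)
      disjoint {z} (z∈xs , z∈ys) =
        proj₂ (proj₁ (Equivalence.to (proj₂ without-C z) z∈ys))
              (proj₂ (proj₁ (Equivalence.to (proj₂ with-C z) z∈xs)))
      to : ∀ z → z ∈ xs ++ ys → Shape P n m z
      to z z∈ with ∈-++⁻ xs z∈
      ... | inj₁ z∈xs = let ((Pz , _) , shape) = Equivalence.to (proj₂ with-C z) z∈xs in Pz , shape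
      ... | inj₂ z∈ys = let ((Pz , _) , shape) = Equivalence.to (proj₂ without-C z) z∈ys in Pz , shape
      from : ∀ z → Shape P n m z → z ∈ xs ++ ys
      from z (Pz , shape) with C? z
      ... | yes Cz = ∈-++⁺ˡ (Equivalence.from (proj₂ with-C z) ((Pz , Cz) , shape))
      ... | no ¬Cz = ∈-++⁺ʳ xs (Equivalence.from (proj₂ without-C z) ((Pz , ¬Cz) , shape))

  StartsWith : ℕ → Pred (List ℕ) 0ℓ → Pred (List ℕ) 0ℓ
  StartsWith a Q []      = ⊥
  StartsWith a Q (b ∷ l) = b ≡ a × Q l

  startsWith? : ∀ {Q} a → Decidable Q → Decidable (StartsWith a Q)
  startsWith? a Q? []      = no (λ ())
  startsWith? a Q? (b ∷ l) = (b ℕ.≟ a) ×-dec Q? l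

  HeadIs : ℕ → Pred (List ℕ) 0ℓ
  HeadIs a []      = ⊥
  HeadIs a (b ∷ _) = b ≡ a

  headIs? : ∀ a → Decidable (HeadIs a)
  headIs? a []      = no (λ ())
  headIs? a (b ∷ _) = b ℕ.≟ a

  head-startsWith : ∀ {P : Pred (List ℕ) 0ℓ} a z → (P ∩ HeadIs a) z ⇔ StartsWith a (λ l → P (a ∷ l)) z
  head-startsWith a []      = mk⇔ (λ ()) (λ ())
  head-startsWith a (b ∷ l) = mk⇔ (λ { (Pz , refl) → refl , Pz }) (λ { (refl , Pz) → Pz , refl })

  count-startsWith : ∀ {Q} a (Q? : Decidable Q) n m → a ≤ m →
    count (startsWith? a Q?) (suc n) m ≡ count Q? n (m ∸ a)
  count-startsWith a Q? n m a≤m = count-transfer Q? (startsWith? a Q?) n (m ∸ a) (suc n) m (a ∷_) List.∷-injectiveʳ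
    (λ { l (Ql , refl , sum≡) → (refl , Ql) , refl , trans (cong (a +_) sum≡) (ℕ.m+[n∸m]≡n a≤m) })
    (λ { (b ∷ l) ((refl , Ql) , refl , refl) → l , refl , Ql , refl , sym (ℕ.m+n∸m≡n a (sum l)) })

  count-startsWith-empty : ∀ {Q} a (Q? : Decidable Q) n m → n ≡ 0 ⊎ m < a → count (startsWith? a Q?) n m ≡ 0
  count-startsWith-empty {Q} a Q? n m no-room = count-empty (startsWith? a Q?) (impossible no-room)
    where
      impossible : ∀ {n m} → n ≡ 0 ⊎ m < a → ∀ z → ¬ Shape (StartsWith a Q) n m z
      impossible (inj₁ refl) (b ∷ l) (_ , () , _)
      impossible (inj₂ m<a)  (b ∷ l) ((refl , _) , _ , refl) = ℕ.<-irrefl refl (ℕ.<-≤-trans m<a (ℕ.m≤m+n b (sum l)))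

  gf : ∀ {P} → Decidable P → Series
  gf P? n m = ℤ.+ count P? n m

  gf-startsWith : ∀ {Q} a (Q? : Decidable Q) n m → gf (startsWith? a Q?) n m ≡ monoMul (ℤ.+ 1) 1 a (gf Q?) n m
  gf-startsWith a Q? zero m = cong ℤ.+_ (count-startsWith-empty a Q? 0 m (inj₁ refl))
  gf-startsWith a Q? (suc n) m with a ≤ᵇ m | ℕ.≤ᵇ-reflects-≤ a m
  ... | true  | ofʸ a≤m = trans (cong ℤ.+_ (count-startsWith a Q? n m a≤m)) (sym (ℤ.*-identityˡ _))
  ... | false | ofⁿ a≰m = cong ℤ.+_ (count-startsWith-empty a Q? (suc n) m (inj₂ (ℕ.≰⇒> a≰m)))

  coeff-gf-cong : ∀ {P Q} (P? : Decidable P) (Q? : Decidable Q) → (∀ z → P z ⇔ Q z) →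
    ∀ N M → coeff (gf P?) N M ≡ coeff (gf Q?) N M
  coeff-gf-cong P? Q? P⇔Q = coeff-cong (λ n m → cong ℤ.+_ (count-cong P? Q? P⇔Q n m))

  coeff-gf-split : ∀ {P C} (P? : Decidable P) (C? : Decidable C) N M →
    coeff (gf P?) N M ≡ coeff (gf (P? ∩? C?)) N M ℤ.+ coeff (gf (P? ∩? ∁? C?)) N M
  coeff-gf-split P? C? N M =
    trans (coeff-cong (λ n m → trans (cong ℤ.+_ (count-split P? C? n m))
                                     (ℤ.pos-+ (count (P? ∩? C?) n m) (count (P? ∩? ∁? C?) n m))) N M)
          (coeff-⊕ (gf (P? ∩? C?)) (gf (P? ∩? ∁? C?)) N M)

  coeff-gf-empty : ∀ {P} (P? : Decidable P) → (∀ z → ¬ P z) → ∀ N M → coeff (gf P?) N M ≡ ℤ.+ 0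
  coeff-gf-empty P? none (ℤ.+ n)    (ℤ.+ m)    = cong ℤ.+_ (count-empty P? {n} {m} (λ z shape → none z (proj₁ shape)))
  coeff-gf-empty P? none (ℤ.+ n)    ℤ.-[1+ m ] = refl
  coeff-gf-empty P? none ℤ.-[1+ n ] M          = refl

  coeff-gf-startsWith : ∀ {P Q} (P? : Decidable P) a (Q? : Decidable Q) → (∀ z → P z ⇔ StartsWith a Q z) →
    ∀ N M → coeff (gf P?) N M ≡ coeff (gf Q?) (N ℤ.- ℤ.+ 1) (M ℤ.- ℤ.+ a)
  coeff-gf-startsWith P? a Q? P⇔ N M =
    trans (coeff-gf-cong P? (startsWith? a Q?) P⇔ N M)
    (trans (coeff-cong (gf-startsWith a Q?) N M)
    (trans (coeff-monoMul (ℤ.+ 1) 1 a (gf Q?) N M) (ℤ.*-identityˡ _)))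

module AscendingForm where
  open import Data.Nat as ℕ using (ℕ; suc; _+_; _*_; _∸_; _≤_; _≤ᵇ_; z≤n; s≤s)
  import Data.Nat.Properties as ℕ
  open import Data.Nat.DivMod using (_%_; [m+kn]%n≡m%n)
  open import Data.Nat.ListAction using (sum)
  open import Data.Nat.ListAction.Properties using (sum-↭)
  open import Data.Nat.Tactic.RingSolver using (solve-∀)
  open import Data.Integer as ℤ using (ℤ)
  open import Data.Bool using (true; false)
  open import Data.Unit using (⊤; tt)
  open import Data.List using (List; []; _∷_; _++_; map; length; reverse; filter)
  import Data.List.Properties as List
  open import Data.List.Relation.Unary.All as All using (All; []; _∷_)
  open import Data.List.Relation.Binary.Permutation.Propositional using (↭-sym)
  open import Data.List.Relation.Binary.Permutation.Propositional.Properties using (↭-reverse; All-resp-↭)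
  open import Data.Product using (_×_; _,_; Σ-syntax)
  open import Data.Product.Function.NonDependent.Propositional using (_×-⇔_)
  open import Function.Base using (id)
  open import Function.Bundles using (_⇔_; mk⇔; Equivalence)
  open import Relation.Nullary using (Dec; ¬_; yes)
  open import Relation.Nullary.Decidable using (_×-dec_; _→-dec_)
  open import Relation.Nullary.Reflects using (ofʸ; ofⁿ)
  open import Relation.Unary using (Decidable)
  open import Relation.Binary.PropositionalEquality
  open Counting

  Close : ℕ → ℕ → Set
  Close a b = b ≤ a + 1 → (b + a) % 3 ≡ 2

  Gap3 : ℕ → List ℕ → Set
  Gap3 a []      = ⊤
  Gap3 a (c ∷ _) = a + 3 ≤ c

  -- The conditions of 𝒫_{T_II} on a list of parts in increasing order.
  Admissible : List ℕ → Set
  Admissible []          = ⊤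
  Admissible (a ∷ [])    = ⊤
  Admissible (a ∷ b ∷ l) = a ≤ b × Close a b × Gap3 a l × Admissible (b ∷ l)

  AdmissibleFrom : ℕ → List ℕ → Set
  AdmissibleFrom u l = Admissible l × All (u ≤_) l

  close? : ∀ a b → Dec (Close a b)
  close? a b = (b ℕ.≤? a + 1) →-dec ((b + a) % 3 ℕ.≟ 2)

  gap3? : ∀ a → Decidable (Gap3 a)
  gap3? a []      = yes tt
  gap3? a (c ∷ _) = a + 3 ℕ.≤? c

  admissible? : Decidable Admissible
  admissible? []          = yes tt
  admissible? (a ∷ [])    = yes tt
  admissible? (a ∷ b ∷ l) = (a ℕ.≤? b) ×-dec close? a b ×-dec gap3? a l ×-dec admissible? (b ∷ l)

  admissibleFrom? : ∀ u → Decidable (AdmissibleFrom u)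
  admissibleFrom? u l = admissible? l ×-dec All.all? (u ℕ.≤?_) l

  admissible-tail : ∀ a l → Admissible (a ∷ l) → Admissible l
  admissible-tail a []      _                 = tt
  admissible-tail a (b ∷ l) (_ , _ , _ , adm) = adm

  admissible-bounded : ∀ a l → Admissible (a ∷ l) → All (a ≤_) l
  admissible-bounded a []      _                   = []
  admissible-bounded a (b ∷ l) (a≤b , _ , _ , adm) = a≤b ∷ All.map (ℕ.≤-trans a≤b) (admissible-bounded b l adm)

  gap3-of-all : ∀ a l → All (a + 3 ≤_) l → Gap3 a l
  gap3-of-all a []      _         = tt
  gap3-of-all a (c ∷ _) (a+3≤c ∷ _) = a+3≤c

  admissible-far-cons : ∀ a l → All (a + 3 ≤_) l → Admissible l → Admissible (a ∷ l)
  admissible-far-cons a []      _                       _   = tt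
  admissible-far-cons a (c ∷ l) (a+3≤c ∷ far) adm =
    ℕ.≤-trans (ℕ.m≤m+n a 3) a+3≤c , close , gap3-of-all a l far , adm
    where
      close : Close a c
      close c≤a+1 with ℕ.+-cancelˡ-≤ a 3 1 (ℕ.≤-trans a+3≤c c≤a+1)
      ... | s≤s ()

  -- Adding 3 to every part preserves admissibility: differences are unchanged
  -- and sums of two parts change by 6.
  shift3 : List ℕ → List ℕ
  shift3 = map (3 +_)

  ≤-shift : ∀ a b → 3 + a ≤ 3 + b ⇔ a ≤ b
  ≤-shift a b = mk⇔ (ℕ.+-cancelˡ-≤ 3 a b) (ℕ.+-monoʳ-≤ 3)

  close-shift : ∀ a b → Close (3 + a) (3 + b) ⇔ Close a b
  close-shift a b = mk⇔
    (λ close b≤a+1 → trans (sym residue) (close (s≤s (s≤s (s≤s b≤a+1)))))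
    (λ { close (s≤s (s≤s (s≤s b≤a+1))) → trans residue (close b≤a+1) })
    where
      six-more : ∀ a b → 3 + b + (3 + a) ≡ b + a + 2 * 3
      six-more = solve-∀
      residue : (3 + b + (3 + a)) % 3 ≡ (b + a) % 3
      residue = trans (cong (_% 3) (six-more a b)) ([m+kn]%n≡m%n (b + a) 2 3)

  gap3-shift : ∀ a l → Gap3 (3 + a) (shift3 l) ⇔ Gap3 a l
  gap3-shift a []      = mk⇔ (λ _ → tt) (λ _ → tt)
  gap3-shift a (c ∷ l) = ≤-shift (a + 3) c

  admissible-shift : ∀ l → Admissible (shift3 l) ⇔ Admissible l
  admissible-shift []          = mk⇔ (λ _ → tt) (λ _ → tt)
  admissible-shift (a ∷ [])    = mk⇔ (λ _ → tt) (λ _ → tt)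
  admissible-shift (a ∷ b ∷ l) =
    ≤-shift a b ×-⇔ close-shift a b ×-⇔ gap3-shift a l ×-⇔ admissible-shift (b ∷ l)

  all-shift : ∀ u l → All (3 + u ≤_) (shift3 l) ⇔ All (u ≤_) l
  all-shift u []      = mk⇔ (λ _ → []) (λ _ → [])
  all-shift u (x ∷ l) = mk⇔
    (λ { (le ∷ bounds) → Equivalence.to (≤-shift u x) le ∷ Equivalence.to (all-shift u l) bounds })
    (λ { (le ∷ bounds) → Equivalence.from (≤-shift u x) le ∷ Equivalence.from (all-shift u l) bounds })

  sum-shift3 : ∀ l → sum (shift3 l) ≡ 3 * length l + sum l
  sum-shift3 []      = refl
  sum-shift3 (x ∷ l) = trans (cong (3 + x +_) (sum-shift3 l)) (regroup x (length l) (sum l))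
    where
      regroup : ∀ x k s → 3 + x + (3 * k + s) ≡ 3 * suc k + (x + s)
      regroup = solve-∀

  unshift : ∀ z → All (3 ≤_) z → Σ[ l ∈ List ℕ ] shift3 l ≡ z
  unshift []      []          = [] , refl
  unshift (x ∷ z) (3≤x ∷ bounds) with unshift z bounds
  ... | l , refl = x ∸ 3 ∷ l , cong (_∷ shift3 l) (ℕ.m+[n∸m]≡n 3≤x)

  sum-lower-bound : ∀ z → All (3 ≤_) z → 3 * length z ≤ sum z
  sum-lower-bound []      []             = z≤n
  sum-lower-bound (x ∷ z) (3≤x ∷ bounds) =
    subst (_≤ x + sum z) (sym (ℕ.*-suc 3 (length z))) (ℕ.+-mono-≤ 3≤x (sum-lower-bound z bounds))

  gf-shift : ∀ u n m → gf (admissibleFrom? (3 + u)) n m ≡ substXq 3 (gf (admissibleFrom? u)) n m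
  gf-shift u n m with 3 * n ≤ᵇ m | ℕ.≤ᵇ-reflects-≤ (3 * n) m
  ... | true  | ofʸ 3n≤m = cong ℤ.+_ (count-transfer (admissibleFrom? u) (admissibleFrom? (3 + u))
                              n (m ∸ 3 * n) n m shift3 (List.map-injective (ℕ.+-cancelˡ-≡ 3 _ _)) forth back)
    where
      forth : ∀ l → Shape (AdmissibleFrom u) n (m ∸ 3 * n) l → Shape (AdmissibleFrom (3 + u)) n m (shift3 l)
      forth l ((adm , bounds) , length≡ , sum≡) =
        (Equivalence.from (admissible-shift l) adm , Equivalence.from (all-shift u l) bounds) ,
        trans (List.length-map (3 +_) l) length≡ ,
        trans (sum-shift3 l) (trans (cong₂ (λ k s → 3 * k + s) length≡ sum≡) (ℕ.m+[n∸m]≡n 3n≤m))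
      back : ∀ z → Shape (AdmissibleFrom (3 + u)) n m z →
        Σ[ l ∈ List ℕ ] shift3 l ≡ z × Shape (AdmissibleFrom u) n (m ∸ 3 * n) l
      back z ((adm , bounds) , length≡ , sum≡) with unshift z (All.map (ℕ.≤-trans (ℕ.m≤m+n 3 u)) bounds)
      ... | l , refl = l , refl ,
        (Equivalence.to (admissible-shift l) adm , Equivalence.to (all-shift u l) bounds) ,
        trans (sym (List.length-map (3 +_) l)) length≡ ,
        trans (sym (ℕ.m+n∸m≡n (3 * length l) (sum l)))
              (cong₂ (λ s k → s ∸ 3 * k) (trans (sym (sum-shift3 l)) sum≡)
                                         (trans (sym (List.length-map (3 +_) l)) length≡))
  ... | false | ofⁿ 3n≰m = cong ℤ.+_ (count-empty (admissibleFrom? (3 + u)) too-small)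
    where
      too-small : ∀ z → ¬ Shape (AdmissibleFrom (3 + u)) n m z
      too-small z ((_ , bounds) , length≡ , sum≡) =
        3n≰m (subst₂ _≤_ (cong (3 *_) length≡) sum≡
               (sum-lower-bound z (All.map (ℕ.≤-trans (ℕ.m≤m+n 3 u)) bounds)))

  Descending : List ℕ → Set
  Descending z = WeaklyDecreasing z × Gap3At2 z × CloseCond z

  Linked : ℕ → List ℕ → Set
  Linked x []          = ⊤
  Linked x (y ∷ [])    = y ≤ x × Close y x
  Linked x (y ∷ w ∷ _) = y ≤ x × Close y x × w + 3 ≤ x

  descending-cons : ∀ x z → Descending (x ∷ z) ⇔ (Descending z × Linked x z)
  descending-cons x []          = mk⇔ (λ _ → (tt , tt , tt) , tt) (λ _ → tt , tt , tt)
  descending-cons x (y ∷ [])    = mk⇔ (λ { ((y≤x , _) , _ , (close , _)) → (tt , tt , tt) , y≤x , close })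
                                      (λ { (_ , y≤x , close) → (y≤x , tt) , tt , (close , tt) })
  descending-cons x (y ∷ w ∷ r) =
    mk⇔ (λ { ((y≤x , dec) , (gap , gaps) , (close , closes)) → (dec , gaps , closes) , y≤x , close , gap })
        (λ { ((dec , gaps , closes) , y≤x , close , gap) → (y≤x , dec) , (gap , gaps) , (close , closes) })

  linked-++ : ∀ x z r → 2 ≤ length z → Linked x (z ++ r) ≡ Linked x z
  linked-++ x (y ∷ [])    r (s≤s ())
  linked-++ x (y ∷ w ∷ z) r _ = refl

  linked-reverse : ∀ x a l → 2 ≤ length l → Linked x (reverse (a ∷ l)) ≡ Linked x (reverse l)
  linked-reverse x a l 2≤l =
    trans (cong (Linked x) (List.unfold-reverse a l))
          (linked-++ x (reverse l) (a ∷ []) (subst (2 ≤_) (sym (List.length-reverse l)) 2≤l))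

  admissible-snoc : ∀ ys x → Admissible (ys ++ x ∷ []) ⇔ (Admissible ys × Linked x (reverse ys))
  admissible-snoc []              x = mk⇔ (λ _ → tt , tt) (λ _ → tt)
  admissible-snoc (b ∷ [])        x = mk⇔ (λ { (b≤x , close , _) → tt , b≤x , close })
                                          (λ { (_ , b≤x , close) → b≤x , close , tt , tt })
  admissible-snoc (a ∷ b ∷ [])    x =
    mk⇔ (λ { (a≤b , close , gap , b≤x , close′ , _) → (a≤b , close , tt , tt) , b≤x , close′ , gap })
        (λ { ((a≤b , close , _) , b≤x , close′ , gap) → a≤b , close , gap , b≤x , close′ , tt , tt })
  admissible-snoc (a ∷ b ∷ c ∷ l) x = extend (admissible-snoc (b ∷ c ∷ l) x)
    where
      linked≡ : Linked x (reverse (a ∷ b ∷ c ∷ l)) ≡ Linked x (reverse (b ∷ c ∷ l))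
      linked≡ = linked-reverse x a (b ∷ c ∷ l) (s≤s (s≤s z≤n))
      extend : Admissible (b ∷ c ∷ l ++ x ∷ []) ⇔ (Admissible (b ∷ c ∷ l) × Linked x (reverse (b ∷ c ∷ l))) →
        Admissible (a ∷ b ∷ c ∷ l ++ x ∷ []) ⇔ (Admissible (a ∷ b ∷ c ∷ l) × Linked x (reverse (a ∷ b ∷ c ∷ l)))
      extend tail⇔ = mk⇔
        (λ { (a≤b , close , gap , adm) → let (adm′ , linked) = Equivalence.to tail⇔ adm in
               (a≤b , close , gap , adm′) , subst id (sym linked≡) linked })
        (λ { ((a≤b , close , gap , adm′) , linked) →
               a≤b , close , gap , Equivalence.from tail⇔ (adm′ , subst id linked≡ linked) })

  descending⇔admissible : ∀ z → Descending z ⇔ Admissible (reverse z)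
  descending⇔admissible []      = mk⇔ (λ _ → tt) (λ _ → tt , tt , tt)
  descending⇔admissible (x ∷ z) = mk⇔
    (λ desc → let (desc′ , linked) = Equivalence.to (descending-cons x z) desc in
      subst Admissible (sym (List.unfold-reverse x z))
        (Equivalence.from (admissible-snoc (reverse z) x)
          (Equivalence.to (descending⇔admissible z) desc′ ,
           subst (Linked x) (sym (List.reverse-involutive z)) linked)))
    (λ adm → let (adm′ , linked) = Equivalence.to (admissible-snoc (reverse z) x)
                                     (subst Admissible (List.unfold-reverse x z) adm) in
      Equivalence.from (descending-cons x z)
        (Equivalence.from (descending⇔admissible z) adm′ , subst (Linked x) (List.reverse-involutive z) linked))

  InPTII⇔admissible : ∀ z → InPTII z ⇔ AdmissibleFrom 1 (reverse z)
  InPTII⇔admissible z = mk⇔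
    (λ { ((dec , positive) , gaps , closes) →
           Equivalence.to (descending⇔admissible z) (dec , gaps , closes) ,
           All-resp-↭ (↭-sym (↭-reverse z)) positive })
    (λ { (adm , positive) → let (dec , gaps , closes) = Equivalence.from (descending⇔admissible z) adm in
           (dec , All-resp-↭ (↭-reverse z) positive) , gaps , closes })

  enumeration-length : ∀ {n m xs} → Enumerates InPTII n m xs → length xs ≡ count (admissibleFrom? 1) n m
  enumeration-length {n} {m} {xs} xs-enumerates =
    trans (enumerations-agree xs-enumerates reversed)
          (List.length-map reverse (filter (admissibleFrom? 1) (compositions n m)))
    where
      reversed : Enumerates InPTII n m (map reverse (filter (admissibleFrom? 1) (compositions n m)))
      reversed = enumerates-map reverse List.reverse-injective
        (λ l (adm , length≡ , sum≡) →
           Equivalence.from (InPTII⇔admissible (reverse l))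
             (subst (AdmissibleFrom 1) (sym (List.reverse-involutive l)) adm) ,
           trans (List.length-reverse l) length≡ , trans (sum-↭ (↭-reverse l)) sum≡)
        (λ z (inPTII , length≡ , sum≡) →
           reverse z , List.reverse-involutive z , Equivalence.to (InPTII⇔admissible z) inPTII ,
           trans (List.length-reverse z) length≡ , trans (sum-↭ (↭-reverse z)) sum≡)
        (count-enumerates (admissibleFrom? 1) n m)

module Recurrences where
  open import Data.Nat as ℕ using (ℕ; suc; _≤_; _<_)
  import Data.Nat.Properties as ℕ
  open import Data.Integer as ℤ using (ℤ; +_; _+_; _-_; _*_)
  import Data.Integer.Properties as ℤ
  open import Data.Integer.Tactic.RingSolver using (solve-∀)
  open import Data.List using (List; []; _∷_; drop)
  open import Data.List.Relation.Unary.All as All using (All; []; _∷_)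
  open import Data.Product using (_×_; _,_)
  open import Data.Empty using (⊥-elim)
  open import Data.Unit using (tt)
  open import Function.Bundles using (_⇔_; mk⇔)
  open import Relation.Nullary using (¬_; yes; no; contradiction)
  open import Relation.Nullary.Decidable using (from-yes; from-no)
  open import Relation.Unary using (Decidable; _∩_; ∁)
  open import Relation.Unary.Properties using (_∩?_; ∁?)
  open import Relation.Binary.PropositionalEquality
  open Coefficients
  open Counting
  open AscendingForm

  -- The lists that can follow a smallest part u, those that can follow two
  -- smallest parts a ≤ b, and those that can follow a smallest part u when
  -- their own smallest part is at least u + 2.
  Tail : ℕ → List ℕ → Set
  Tail u l = AdmissibleFrom u (u ∷ l)

  Pair : ℕ → ℕ → List ℕ → Set
  Pair a b l = AdmissibleFrom a (a ∷ b ∷ l)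

  Wide : ℕ → List ℕ → Set
  Wide u l = AdmissibleFrom (suc (suc u)) l × Gap3 u (drop 1 l)

  tail? : ∀ u → Decidable (Tail u)
  tail? u l = admissibleFrom? u (u ∷ l)

  pair? : ∀ a b → Decidable (Pair a b)
  pair? a b l = admissibleFrom? a (a ∷ b ∷ l)

  secondGap3? : ∀ u → Decidable (λ l → Gap3 u (drop 1 l))
  secondGap3? u l = gap3? u (drop 1 l)

  wide? : ∀ u → Decidable (Wide u)
  wide? u = admissibleFrom? (suc (suc u)) ∩? secondGap3? u

  all-above-gap : ∀ a l → Gap3 a l → Admissible l → All (a ℕ.+ 3 ≤_) l
  all-above-gap a []      _     _   = []
  all-above-gap a (c ∷ l) a+3≤c adm = a+3≤c ∷ All.map (ℕ.≤-trans a+3≤c) (admissible-bounded c l adm)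

  -- Gap3 is phrased with a + 3, the shifted lower bounds with 3 + a.
  commute3 : ∀ {a c} → a ℕ.+ 3 ≤ c → 3 ℕ.+ a ≤ c
  commute3 {a} {c} = subst (λ x → x ≤ c) (ℕ.+-comm a 3)

  commute3⁻ : ∀ {a c} → 3 ℕ.+ a ≤ c → a ℕ.+ 3 ≤ c
  commute3⁻ {a} {c} = subst (λ x → x ≤ c) (ℕ.+-comm 3 a)

  not-starting-with : ∀ u z → (AdmissibleFrom u ∩ ∁ (HeadIs u)) z ⇔ AdmissibleFrom (suc u) z
  not-starting-with u []      = mk⇔ (λ _ → tt , []) (λ _ → (tt , []) , λ ())
  not-starting-with u (c ∷ l) = mk⇔
    (λ { ((adm , u≤c ∷ _) , c≢u) →
           let u<c = ℕ.≤∧≢⇒< u≤c (λ u≡c → c≢u (sym u≡c)) in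
           adm , u<c ∷ All.map (ℕ.≤-trans u<c) (admissible-bounded c l adm) })
    (λ { (adm , u<c ∷ bounds) →
           (adm , ℕ.<⇒≤ u<c ∷ All.map (ℕ.≤-trans (ℕ.n≤1+n u)) bounds) ,
           λ { refl → ℕ.<-irrefl refl u<c } })

  second-is-successor : ∀ u z →
    ((Tail u ∩ ∁ (HeadIs u)) ∩ HeadIs (suc u)) z ⇔ StartsWith (suc u) (Pair u (suc u)) z
  second-is-successor u []      = mk⇔ (λ ()) (λ ())
  second-is-successor u (c ∷ l) = mk⇔
    (λ { ((tail , _) , refl) → refl , tail })
    (λ { (refl , pair) → (pair , ℕ.1+n≢n) , refl })

  -- A second part different from u and u + 1 is at least u + 2; it makes no
  -- Close condition with u, and only the gap condition involves u.
  second-far : ∀ u z → ((Tail u ∩ ∁ (HeadIs u)) ∩ ∁ (HeadIs (suc u))) z ⇔ Wide u z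
  second-far u []      = mk⇔ (λ _ → (tt , []) , tt) (λ _ → ((tt , ℕ.≤-refl ∷ []) , λ ()) , λ ())
  second-far u (c ∷ l) = mk⇔
    (λ { ((((_ , _ , gap , adm) , _ ∷ u≤c ∷ _) , c≢u) , c≢1+u) →
           let u<c  = ℕ.≤∧≢⇒< u≤c (λ u≡c → c≢u (sym u≡c))
               u+1<c = ℕ.≤∧≢⇒< u<c (λ 1+u≡c → c≢1+u (sym 1+u≡c)) in
           (adm , u+1<c ∷ All.map (ℕ.≤-trans u+1<c) (admissible-bounded c l adm)) , gap })
    (λ { ((adm , u+2≤c ∷ bounds) , gap) →
           let u≤c = ℕ.≤-trans (ℕ.n≤1+n u) (ℕ.≤-trans (ℕ.n≤1+n (suc u)) u+2≤c) in
           (((u≤c , close u+2≤c , gap , adm) ,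
             ℕ.≤-refl ∷ u≤c ∷ All.map (ℕ.≤-trans (ℕ.≤-trans (ℕ.n≤1+n u) (ℕ.n≤1+n (suc u)))) bounds) ,
             λ { refl → ℕ.<-irrefl refl (ℕ.≤-trans (ℕ.n≤1+n (suc c)) u+2≤c) }) ,
           λ { refl → ℕ.<-irrefl refl u+2≤c } })
    where
      close : ∀ {c} → suc (suc u) ≤ c → Close u c
      close {c} u+2≤c c≤u+1 =
        contradiction (ℕ.≤-trans u+2≤c (subst (λ x → c ≤ x) (ℕ.+-comm u 1) c≤u+1)) (ℕ.<-irrefl refl)

  doubled : ∀ u z → let w = suc (suc u) in
    (AdmissibleFrom w ∩ ∁ (λ l → Gap3 u (drop 1 l))) z ⇔ StartsWith w (StartsWith w (Pair w w)) z
  doubled u []          = mk⇔ (λ { (_ , no-gap) → ⊥-elim (no-gap tt) }) (λ ())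
  doubled u (c ∷ [])    = mk⇔ (λ { (_ , no-gap) → ⊥-elim (no-gap tt) }) (λ { (_ , ()) })
  doubled u (c ∷ d ∷ r) = mk⇔
    (λ { (adm@((c≤d , _) , w≤c ∷ w≤d ∷ _) , no-gap) →
           let d≤w = ℕ.≤-pred (subst (d <_) (ℕ.+-comm u 3) (ℕ.≰⇒> no-gap))
               d≡w = ℕ.≤-antisym d≤w w≤d
               c≡w = ℕ.≤-antisym (ℕ.≤-trans c≤d d≤w) w≤c in
           starts c≡w d≡w adm })
    (λ { (refl , refl , pair) →
           pair , λ u+3≤w → ℕ.<-irrefl refl (subst (λ x → x ≤ suc (suc u)) (ℕ.+-comm u 3) u+3≤w) })
    where
      starts : ∀ {c d} → c ≡ suc (suc u) → d ≡ suc (suc u) → AdmissibleFrom (suc (suc u)) (c ∷ d ∷ r) →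
        StartsWith (suc (suc u)) (StartsWith (suc (suc u)) (Pair (suc (suc u)) (suc (suc u)))) (c ∷ d ∷ r)
      starts refl refl adm = refl , refl , adm

  pair-close : ∀ a b l → Pair a b l → Close a b
  pair-close a b l ((_ , close , _) , _) = close

  pair-repeated : ∀ w l → Close w w → Pair w w l ⇔ AdmissibleFrom (3 ℕ.+ w) l
  pair-repeated w l close = mk⇔
    (λ { ((_ , _ , gap , adm) , _) →
           let adm′ = admissible-tail w l adm in
           adm′ , All.map commute3 (all-above-gap w l gap adm′) })
    (λ { (adm , bounds) →
           let far = All.map commute3⁻ bounds in
           (ℕ.≤-refl , close , gap3-of-all w l far , admissible-far-cons w l far adm) ,
           ℕ.≤-refl ∷ ℕ.≤-refl ∷ All.map (ℕ.≤-trans (ℕ.m≤n+m w 3)) bounds })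

  pair-consecutive : ∀ u l → Close u (suc u) → ¬ Close (3 ℕ.+ u) (3 ℕ.+ u) →
    Pair u (suc u) l ⇔ AdmissibleFrom (3 ℕ.+ u) l
  pair-consecutive u l close not-close = mk⇔
    (λ { ((_ , _ , gap , adm) , _) →
           let adm′ = admissible-tail (suc u) l adm in
           adm′ , All.map commute3 (all-above-gap u l gap adm′) })
    (λ { (adm , bounds) →
           (ℕ.n≤1+n u , close , gap3-of-all u l (All.map commute3⁻ bounds) , after-successor l adm bounds) ,
           ℕ.≤-refl ∷ ℕ.n≤1+n u ∷ All.map (ℕ.≤-trans (ℕ.m≤n+m u 3)) bounds })
    where
      -- parts ≥ u + 3 make no Close condition with u + 1, and the second of
      -- them is ≥ u + 4 since two parts u + 3 are not adjacent
      after-successor : ∀ l → Admissible l → All (3 ℕ.+ u ≤_) l → Admissible (suc u ∷ l)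
      after-successor []          _   _ = tt
      after-successor (c ∷ l) adm (u+3≤c ∷ bounds) =
        ℕ.≤-trans (ℕ.n≤1+n (suc u)) (ℕ.≤-trans (ℕ.n≤1+n (suc (suc u))) u+3≤c) ,
        (λ c≤u+2 → contradiction (ℕ.≤-trans u+3≤c (subst (λ x → c ≤ x) (ℕ.+-comm (suc u) 1) c≤u+2))
                                 (ℕ.<-irrefl refl)) ,
        second-gap l adm bounds , adm
        where
          second-gap : ∀ l → Admissible (c ∷ l) → All (3 ℕ.+ u ≤_) l → Gap3 (suc u) l
          second-gap []      _                    _              = tt
          second-gap (d ∷ _) (c≤d , close′ , _) (u+3≤d ∷ _) with suc u ℕ.+ 3 ℕ.≤? d
          ... | yes u+4≤d = u+4≤d
          ... | no  u+4≰d =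
            let d≤u+3 = ℕ.≤-pred (subst (λ x → d < x) (ℕ.+-comm (suc u) 3) (ℕ.≰⇒> u+4≰d))
                d≡u+3 = ℕ.≤-antisym d≤u+3 u+3≤d
                c≡u+3 = ℕ.≤-antisym (ℕ.≤-trans c≤d d≤u+3) u+3≤c in
            ⊥-elim (not-close (subst₂ Close c≡u+3 d≡u+3 close′))

  -- Coefficients: T u counts admissible lists with parts ≥ u (G₁ = G is the
  -- series of the theorem), U u the possible tails after a smallest part u,
  -- S a b those after smallest parts a, b, and W u the wide tails.
  T : ℕ → ℤ → ℤ → ℤ
  T u = coeff (gf (admissibleFrom? u))

  U : ℕ → ℤ → ℤ → ℤ
  U u = coeff (gf (tail? u))

  S : ℕ → ℕ → ℤ → ℤ → ℤ
  S a b = coeff (gf (pair? a b))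

  W : ℕ → ℤ → ℤ → ℤ
  W u = coeff (gf (wide? u))

  by-smallest : ∀ u N M → T u N M ≡ T (suc u) N M + U u (N - + 1) (M - + u)
  by-smallest u N M =
    trans (coeff-gf-split (admissibleFrom? u) (headIs? u) N M)
    (trans (cong₂ _+_ (coeff-gf-startsWith (admissibleFrom? u ∩? headIs? u) u (tail? u) (head-startsWith u) N M)
                      (coeff-gf-cong (admissibleFrom? u ∩? ∁? (headIs? u)) (admissibleFrom? (suc u))
                                     (not-starting-with u) N M))
           (ℤ.+-comm (U u (N - + 1) (M - + u)) (T (suc u) N M)))

  by-second : ∀ u N M →
    U u N M ≡ S u u (N - + 1) (M - + u) + (S u (suc u) (N - + 1) (M - + suc u) + W u N M)
  by-second u N M =
    trans (coeff-gf-split (tail? u) (headIs? u) N M)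
    (cong₂ _+_ (coeff-gf-startsWith (tail? u ∩? headIs? u) u (pair? u u) (head-startsWith u) N M)
    (trans (coeff-gf-split (tail? u ∩? ∁? (headIs? u)) (headIs? (suc u)) N M)
    (cong₂ _+_ (coeff-gf-startsWith ((tail? u ∩? ∁? (headIs? u)) ∩? headIs? (suc u)) (suc u) (pair? u (suc u))
                                    (second-is-successor u) N M)
               (coeff-gf-cong ((tail? u ∩? ∁? (headIs? u)) ∩? ∁? (headIs? (suc u))) (wide? u) (second-far u) N M))))

  by-doubled : ∀ u N M → let w = suc (suc u) in
    W u N M ≡ T w N M - S w w (N - + 1 - + 1) (M - + w - + w)
  by-doubled u N M = solve-for-W (trans (coeff-gf-split (admissibleFrom? w) (secondGap3? u) N M)
    (cong (λ t → W u N M + t) (trans (coeff-gf-startsWith (admissibleFrom? w ∩? ∁? (secondGap3? u)) w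
                                                   (startsWith? w (pair? w w)) (doubled u) N M)
                              (coeff-gf-startsWith (startsWith? w (pair? w w)) w (pair? w w)
                                                   (λ _ → mk⇔ (λ p → p) (λ p → p)) (N - + 1) (M - + w)))))
    where
      w : ℕ
      w = suc (suc u)
      solve-for-W : ∀ {t x s} → t ≡ x + s → x ≡ t - s
      solve-for-W {x = x} {s} refl = sym (cancel x s)
        where
          cancel : ∀ x s → x + s - s ≡ x
          cancel = solve-∀

  first-parts : ∀ u N M → let w = suc (suc u) in
    T u N M ≡ T (suc u) N M + (S u u (N - + 1 - + 1) (M - + u - + u)
                              + (S u (suc u) (N - + 1 - + 1) (M - + u - + suc u)
                                 + (T w (N - + 1) (M - + u) - S w w (N - + 1 - + 1 - + 1) (M - + u - + w - + w))))
  first-parts u N M =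
    trans (by-smallest u N M)
          (cong (λ t → T (suc u) N M + t)
                (trans (by-second u N₁ M₁)
                       (cong (λ t → S u u (N₁ - + 1) (M₁ - + u) + (S u (suc u) (N₁ - + 1) (M₁ - + suc u) + t))
                             (by-doubled u N₁ M₁))))
    where
      N₁ M₁ : ℤ
      N₁ = N - + 1
      M₁ = M - + u

  S-not-close : ∀ a b → ¬ Close a b → ∀ N M → S a b N M ≡ + 0
  S-not-close a b not-close = coeff-gf-empty (pair? a b) (λ l pair → not-close (pair-close a b l pair))

  S-repeated : ∀ w → Close w w → ∀ N M → S w w N M ≡ T (3 ℕ.+ w) N M
  S-repeated w close = coeff-gf-cong (pair? w w) (admissibleFrom? (3 ℕ.+ w)) (λ l → pair-repeated w l close)

  S-consecutive : ∀ u → Close u (suc u) → ¬ Close (3 ℕ.+ u) (3 ℕ.+ u) → ∀ N M → S u (suc u) N M ≡ T (3 ℕ.+ u) N M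
  S-consecutive u close not-close =
    coeff-gf-cong (pair? u (suc u)) (admissibleFrom? (3 ℕ.+ u)) (λ l → pair-consecutive u l close not-close)

  T-shift : ∀ u N M → T (3 ℕ.+ u) N M ≡ T u N (M - + 3 * N)
  T-shift u N M = trans (coeff-cong (gf-shift u) N M) (coeff-substXq 3 (gf (admissibleFrom? u)) N M)

  -- The three recurrences, from first-parts with u = 1, 2, 3: the residues of
  -- 2u and 2u + 1 mod 3 decide which pairs of smallest parts may occur.
  recurrence₁ : ∀ N M → T 1 N M ≡ T 2 N M + T 3 (N - + 1) (M - + 1)
                                   + T 1 (N - + 1 - + 1) (M - + 1 - + 1 - + 3 * (N - + 1 - + 1))
  recurrence₁ N M = rearrange (T 2 N M) (T 3 (N - + 1) (M - + 1)) (first-parts 1 N M)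
    (trans (S-repeated 1 (from-yes (close? 1 1)) N₂ (M - + 1 - + 1)) (T-shift 1 N₂ (M - + 1 - + 1)))
    (S-not-close 1 2 (from-no (close? 1 2)) N₂ (M - + 1 - + 2))
    (S-not-close 3 3 (from-no (close? 3 3)) (N₂ - + 1) (M - + 1 - + 3 - + 3))
    where
      N₂ : ℤ
      N₂ = N - + 1 - + 1
      rearrange : ∀ t₂ t₃ {t s₁₁ s₁₂ s₃₃ y} → t ≡ t₂ + (s₁₁ + (s₁₂ + (t₃ - s₃₃))) →
        s₁₁ ≡ y → s₁₂ ≡ + 0 → s₃₃ ≡ + 0 → t ≡ t₂ + t₃ + y
      rearrange t₂ t₃ {y = y} refl refl refl refl = regroup t₂ t₃ y
        where
          regroup : ∀ a b c → a + (c + (+ 0 + (b - + 0))) ≡ a + b + c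
          regroup = solve-∀

  recurrence₂ : ∀ N M → T 2 N M ≡ T 3 N M + T 2 (N - + 1 - + 1) (M - + 2 - + 3 - + 3 * (N - + 1 - + 1))
                                   + T 1 (N - + 1) (M - + 2 - + 3 * (N - + 1))
                                   - T 1 (N - + 1 - + 1 - + 1) (M - + 2 - + 4 - + 4 - + 3 * (N - + 1 - + 1 - + 1)
                                                                             - + 3 * (N - + 1 - + 1 - + 1))
  recurrence₂ N M = rearrange (T 3 N M) (first-parts 2 N M)
    (S-not-close 2 2 (from-no (close? 2 2)) N₂ (M - + 2 - + 2))
    (trans (S-consecutive 2 (from-yes (close? 2 3)) (from-no (close? 5 5)) N₂ (M - + 2 - + 3))
           (T-shift 2 N₂ (M - + 2 - + 3)))
    (T-shift 1 (N - + 1) (M - + 2))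
    (trans (S-repeated 4 (from-yes (close? 4 4)) N₃ M₃) (trans (T-shift 4 N₃ M₃) (T-shift 1 N₃ (M₃ - + 3 * N₃))))
    where
      N₂ N₃ M₃ : ℤ
      N₂ = N - + 1 - + 1
      N₃ = N₂ - + 1
      M₃ = M - + 2 - + 4 - + 4
      rearrange : ∀ t₃ {t s₂₂ s₂₃ t₄ s₄₄ y₂ y₁ y₁′} → t ≡ t₃ + (s₂₂ + (s₂₃ + (t₄ - s₄₄))) →
        s₂₂ ≡ + 0 → s₂₃ ≡ y₂ → t₄ ≡ y₁ → s₄₄ ≡ y₁′ → t ≡ t₃ + y₂ + y₁ - y₁′
      rearrange t₃ {y₂ = y₂} {y₁} {y₁′} refl refl refl refl refl = regroup t₃ y₂ y₁ y₁′
        where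
          regroup : ∀ a b c d → a + (+ 0 + (b + (c - d))) ≡ a + b + c - d
          regroup = solve-∀

  recurrence₃ : ∀ N M → T 3 N M ≡ T 1 N (M - + 3 * N) + T 2 (N - + 1) (M - + 3 - + 3 * (N - + 1))
  recurrence₃ N M = rearrange (first-parts 3 N M)
    (T-shift 1 N M)
    (S-not-close 3 3 (from-no (close? 3 3)) N₂ (M - + 3 - + 3))
    (S-not-close 3 4 (from-no (close? 3 4)) N₂ (M - + 3 - + 4))
    (T-shift 2 (N - + 1) (M - + 3))
    (S-not-close 5 5 (from-no (close? 5 5)) (N₂ - + 1) (M - + 3 - + 5 - + 5))
    where
      N₂ : ℤ
      N₂ = N - + 1 - + 1
      rearrange : ∀ {t t₄ s₃₃ s₃₄ t₅ s₅₅ y₁ y₂} → t ≡ t₄ + (s₃₃ + (s₃₄ + (t₅ - s₅₅))) →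
        t₄ ≡ y₁ → s₃₃ ≡ + 0 → s₃₄ ≡ + 0 → t₅ ≡ y₂ → s₅₅ ≡ + 0 → t ≡ y₁ + y₂
      rearrange {y₁ = y₁} {y₂} refl refl refl refl refl refl = regroup y₁ y₂
        where
          regroup : ∀ a b → a + (+ 0 + (+ 0 + (b - + 0))) ≡ a + b
          regroup = solve-∀

module RecurrenceForms where
  open import Data.Integer using (+_; _+_; _-_; _*_; -_)
  open import Data.Integer.Tactic.RingSolver using (solve)
  open import Data.List using ([]; _∷_)
  open import Data.Product using (_,_)
  open import Relation.Binary.PropositionalEquality
  open LinearForms
  open FunctionalEquation
  open Recurrences

  atom≡ : ∀ k a b s N M N′ M′ → N - + a ≡ N′ → M - + b - + s * (N - + a) ≡ M′ →
    atomValue T (k , a , b , s) N M ≡ T k N′ M′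
  atom≡ k a b s N M N′ M′ = cong₂ (T k)

  atom-origin : ∀ k N M → atomValue T (k , 0 , 0 , 0) N M ≡ T k N M
  atom-origin k N M = atom≡ k 0 0 0 N M N M (solve (N ∷ [])) (solve (N ∷ M ∷ []))

  satisfies-recurrences : ∀ i → Satisfies T (recurrence i)
  satisfies-recurrences R₁ N M = vanishes
    (atom-origin 1 N M) (atom-origin 2 N M)
    (atom≡ 3 1 1 0 N M (N - + 1) (M - + 1) refl (solve (N ∷ M ∷ [])))
    (atom≡ 1 2 2 3 N M (N - + 1 - + 1) (M - + 1 - + 1 - + 3 * (N - + 1 - + 1))
           (solve (N ∷ [])) (solve (N ∷ M ∷ [])))
    (recurrence₁ N M)
    where
      vanishes : ∀ {x₁ x₂ x₃ x₄ y₁ y₂ y₃ y₄} → x₁ ≡ y₁ → x₂ ≡ y₂ → x₃ ≡ y₃ → x₄ ≡ y₄ → y₁ ≡ y₂ + y₃ + y₄ →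
        + 1 * x₁ + (- + 1 * x₂ + (- + 1 * x₃ + (- + 1 * x₄ + + 0))) ≡ + 0
      vanishes {y₂ = y₂} {y₃} {y₄} refl refl refl refl refl = solve (y₂ ∷ y₃ ∷ y₄ ∷ [])
  satisfies-recurrences R₂ N M = vanishes
    (atom-origin 2 N M) (atom-origin 3 N M)
    (atom≡ 2 2 5 3 N M (N - + 1 - + 1) (M - + 2 - + 3 - + 3 * (N - + 1 - + 1))
           (solve (N ∷ [])) (solve (N ∷ M ∷ [])))
    (atom≡ 1 1 2 3 N M (N - + 1) (M - + 2 - + 3 * (N - + 1)) refl refl)
    (atom≡ 1 3 10 6 N M (N - + 1 - + 1 - + 1)
           (M - + 2 - + 4 - + 4 - + 3 * (N - + 1 - + 1 - + 1) - + 3 * (N - + 1 - + 1 - + 1))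
           (solve (N ∷ [])) (solve (N ∷ M ∷ [])))
    (recurrence₂ N M)
    where
      vanishes : ∀ {x₁ x₂ x₃ x₄ x₅ y₁ y₂ y₃ y₄ y₅} → x₁ ≡ y₁ → x₂ ≡ y₂ → x₃ ≡ y₃ → x₄ ≡ y₄ → x₅ ≡ y₅ →
        y₁ ≡ y₂ + y₃ + y₄ - y₅ → + 1 * x₁ + (- + 1 * x₂ + (- + 1 * x₃ + (- + 1 * x₄ + (+ 1 * x₅ + + 0)))) ≡ + 0
      vanishes {y₂ = y₂} {y₃} {y₄} {y₅} refl refl refl refl refl refl = solve (y₂ ∷ y₃ ∷ y₄ ∷ y₅ ∷ [])
  satisfies-recurrences R₃ N M = vanishes
    (atom-origin 3 N M)
    (atom≡ 1 0 0 3 N M N (M - + 3 * N) (solve (N ∷ [])) (solve (N ∷ M ∷ [])))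
    (atom≡ 2 1 3 3 N M (N - + 1) (M - + 3 - + 3 * (N - + 1)) refl refl)
    (recurrence₃ N M)
    where
      vanishes : ∀ {x₁ x₂ x₃ y₁ y₂ y₃} → x₁ ≡ y₁ → x₂ ≡ y₂ → x₃ ≡ y₃ → y₁ ≡ y₂ + y₃ →
        + 1 * x₁ + (- + 1 * x₂ + (- + 1 * x₃ + + 0)) ≡ + 0
      vanishes {y₂ = y₂} {y₃} refl refl refl refl = solve (y₂ ∷ y₃ ∷ [])

open import Data.Nat using (ℕ)
open import Data.Integer using (+_)
open import Data.List using (List; length)
open import Data.Nat.ListAction using (sum)
open import Data.List.Membership.Propositional using (_∈_)
open import Data.List.Relation.Unary.Unique.Propositional using (Unique)
open import Data.Product using (_×_; _,_)
open import Function.Bundles using (_⇔_)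
open import Relation.Binary.PropositionalEquality using (_≡_; cong; module ≡-Reasoning)
open ≡-Reasoning
open Coefficients using (coeff; coeff-cong)
open LinearForms using (⟦_⟧)
open FunctionalEquation using (lhsForm; lhsForm-vanishes; lhsSeries-form)
open AscendingForm using (enumeration-length)
open Recurrences using (T)
open RecurrenceForms using (satisfies-recurrences)

mainTheorem9 : (L : ℕ → ℕ → List (List ℕ))
    → (∀ n m → Unique (L n m))
    → (∀ n m (p : List ℕ) → (p ∈ L n m) ⇔ (InPTII p × length p ≡ n × sum p ≡ m))
    → ∀ n m → lhsSeries (λ a b → + length (L a b)) n m ≡ + 0
mainTheorem9 L unique enumerates n m = begin
  lhsSeries G n m            ≡⟨ lhsSeries-form G T G-is-T₁ n m ⟩
  ⟦ lhsForm ⟧ T (+ n) (+ m)  ≡⟨ lhsForm-vanishes T satisfies-recurrences (+ n) (+ m) ⟩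
  + 0                        ∎
  where
    G : Series
    G a b = + length (L a b)
    G-is-T₁ : ∀ N M → coeff G N M ≡ T 1 N M
    G-is-T₁ = coeff-cong (λ a b → cong +_ (enumeration-length (unique a b , enumerates a b)))
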